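{- Let $n$ be a positive integer. Then $\mathrm{SG}(n^2)=\mathrm{SG}(2^n)=2$ if $n$ is odd and $=0$ if $n$ is even.
   Context: $(a^k)$ denotes the partition with $k$ parts equal to $a$. LCTR: positions are partitions; from nonempty $\lambda=(\lambda_1,\dots,\lambda_k)$ one may move to $T(\lambda)=(\lambda_2,\dots,\lambda_k)$ or $L(\lambda)=(\lambda_1-1,\dots,\lambda_k-1)$ (nonpositive entries omitted); $()$ has no moves. $\mathrm{SG}(())=0$, $\mathrm{SG}(\lambda)=\mathrm{mex}\{\mathrm{SG}(L(\lambda)),\mathrm{SG}(T(\lambda))\}$ otherwise, with $\mathrm{mex}(B)$ the least nonnegative integer not in $B$. -}

module Defs where

open import Data.Nat using (ℕ; zero; suc; _+_; _≟_)
open import Data.List using (List; []; _∷_; length; replicate)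
open import Data.Nat.ListAction using (sum)
open import Data.List.Membership.DecPropositional (_≟_) using (_∈?_)
open import Relation.Nullary using (yes; no)

-- A partition is represented as a list of positive naturals in weakly
-- decreasing order (λ₁ ≥ λ₂ ≥ … ≥ λₖ ≥ 1).
Partition : Set
Partition = List ℕ

T : Partition → Partition
T []       = []
T (_ ∷ xs) = xs

L : Partition → Partition
L []                  = []
L (zero ∷ xs)         = L xs
L (suc zero ∷ xs)     = L xs
L (suc (suc k) ∷ xs)  = suc k ∷ L xs

-- mex B: least nonnegative integer not in the finite set B (given as a list).
-- Search starting from m with a bound of fuel steps; fuel = length B + 1 suffices.
mexFrom : ℕ → ℕ → List ℕ → ℕ
mexFrom zero     m B = m
mexFrom (suc f) m B with m ∈? B
... | yes _ = mexFrom f (suc m) B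
... | no  _ = m

mex : List ℕ → ℕ
mex B = mexFrom (suc (length B)) 0 B

-- Sprague–Grundy value of LCTR, by recursion on a fuel parameter.
-- Every move from a nonempty position strictly decreases (sum + length),
-- so fuel = suc (sum λ + length λ) is always enough.
SGf : ℕ → Partition → ℕ
SGf zero    _  = 0
SGf (suc f) [] = 0
SGf (suc f) λ′@(_ ∷ _) = mex (SGf f (L λ′) ∷ SGf f (T λ′) ∷ [])

SG : Partition → ℕ
SG λ′ = SGf (suc (sum λ′ + length λ′)) λ′

_^ₚ_ : ℕ → ℕ → Partition
a ^ₚ k = replicate k a

-- Every move of LCTR strictly decreases the size Σλᵢ + #λ, so the fuel in SGf is irrelevant
-- once it exceeds the size and SG obeys its defining recursion. Along the four families
-- (1^m), (m), (m,m) and (2^m) every move stays inside the families, and one-step induction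
-- shows that the values alternate with the parity of m: 1, 2 on (1^m) and (m), and 2, 0 on
-- (m,m) and (2^m). In particular (n,n) = n^ₚ 2 and (2^n) = 2 ^ₚ n share the value 2 or 0.
module Submission where

open import Defs
open import Data.Nat using (ℕ; _≤_; _<_; _%_; zero; suc; _+_; _*_; _∸_; z≤n; s≤s; s≤s⁻¹)
open import Data.Nat.Properties using (≤-refl; <⇒≤; <-≤-trans; +-monoʳ-≤; m≤n+m; +-suc; +-assoc)
open import Data.List using ([]; _∷_; length)
open import Data.Nat.ListAction using (sum)
open import Data.Product using (_×_; _,_)
open import Relation.Binary.PropositionalEquality using (_≡_; refl; sym; trans; cong; cong₂; subst; module ≡-Reasoning)

size : Partition → ℕ
size []       = 0
size (x ∷ xs) = suc (x + size xs)

size≡sum+length : ∀ λ′ → size λ′ ≡ sum λ′ + length λ′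
size≡sum+length []       = refl
size≡sum+length (x ∷ xs) = begin
  suc (x + size xs)             ≡⟨ cong (λ s → suc (x + s)) (size≡sum+length xs) ⟩
  suc (x + (sum xs + length xs)) ≡⟨ cong suc (sym (+-assoc x (sum xs) (length xs))) ⟩
  suc (x + sum xs + length xs)   ≡⟨ sym (+-suc (x + sum xs) (length xs)) ⟩
  x + sum xs + suc (length xs)   ∎
  where open ≡-Reasoning

size-L≤ : ∀ λ′ → size (L λ′) ≤ size λ′
size-L< : ∀ x xs → size (L (x ∷ xs)) < size (x ∷ xs)

size-L≤ []       = z≤n
size-L≤ (x ∷ xs) = <⇒≤ (size-L< x xs)

size-L< zero          xs = s≤s (size-L≤ xs)
size-L< (suc zero)    xs = s≤s (<⇒≤ (s≤s (size-L≤ xs)))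
size-L< (suc (suc k)) xs = s≤s (s≤s (s≤s (+-monoʳ-≤ k (size-L≤ xs))))

size-T< : ∀ x xs → size (T (x ∷ xs)) < size (x ∷ xs)
size-T< x xs = s≤s (m≤n+m (size xs) x)

mex₂ : ℕ → ℕ → ℕ
mex₂ a b = mex (a ∷ b ∷ [])

SGf-fuel-irrelevant : ∀ {f g} λ′ → size λ′ < f → size λ′ < g → SGf f λ′ ≡ SGf g λ′
SGf-fuel-irrelevant {suc f} {suc g} []       _  _  = refl
SGf-fuel-irrelevant {suc f} {suc g} (x ∷ xs) <f <g = cong₂ mex₂
  (SGf-fuel-irrelevant (L (x ∷ xs)) (shrinks (size-L< x xs) <f) (shrinks (size-L< x xs) <g))
  (SGf-fuel-irrelevant xs (shrinks (size-T< x xs) <f) (shrinks (size-T< x xs) <g))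
  where
  shrinks : ∀ {m n h} → m < n → n < suc h → m < h
  shrinks m<n n<1+h = <-≤-trans m<n (s≤s⁻¹ n<1+h)

SG≡SGf : ∀ {f} λ′ → size λ′ < f → SG λ′ ≡ SGf f λ′
SG≡SGf λ′ = SGf-fuel-irrelevant λ′ (s≤s (subst (size λ′ ≤_) (size≡sum+length λ′) ≤-refl))

SG-step : ∀ x xs → SG (x ∷ xs) ≡ mex₂ (SG (L (x ∷ xs))) (SG xs)
SG-step x xs = sym (cong₂ mex₂ (SG≡SGf (L (x ∷ xs)) (fuel (size-L< x xs))) (SG≡SGf xs (fuel (size-T< x xs))))
  where
  fuel : ∀ {m} → m < size (x ∷ xs) → m < sum (x ∷ xs) + length (x ∷ xs)
  fuel {m} = subst (m <_) (size≡sum+length (x ∷ xs))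

L-ones : ∀ n → L (1 ^ₚ n) ≡ []
L-ones zero    = refl
L-ones (suc n) = L-ones n

L-twos : ∀ n → L (2 ^ₚ n) ≡ 1 ^ₚ n
L-twos zero    = refl
L-twos (suc n) = cong (1 ∷_) (L-twos n)

-- The values 1, 2 (m odd, even) are 2 ∸ m % 2; the values 2, 0 are 2 * (m % 2).
mex₂-0-∸ : ∀ m → mex₂ 0 (2 ∸ m % 2) ≡ 2 ∸ suc m % 2
mex₂-0-∸ zero          = refl
mex₂-0-∸ (suc zero)    = refl
mex₂-0-∸ (suc (suc m)) = mex₂-0-∸ m

mex₂-∸-0 : ∀ m → mex₂ (2 ∸ m % 2) 0 ≡ 2 ∸ suc m % 2
mex₂-∸-0 zero          = refl
mex₂-∸-0 (suc zero)    = refl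
mex₂-∸-0 (suc (suc m)) = mex₂-∸-0 m

mex₂-*-∸ : ∀ m → mex₂ (2 * (m % 2)) (2 ∸ suc m % 2) ≡ 2 * (suc m % 2)
mex₂-*-∸ zero          = refl
mex₂-*-∸ (suc zero)    = refl
mex₂-*-∸ (suc (suc m)) = mex₂-*-∸ m

mex₂-∸-* : ∀ m → mex₂ (2 ∸ suc m % 2) (2 * (m % 2)) ≡ 2 * (suc m % 2)
mex₂-∸-* zero          = refl
mex₂-∸-* (suc zero)    = refl
mex₂-∸-* (suc (suc m)) = mex₂-∸-* m

SG-ones : ∀ n → SG (1 ^ₚ suc n) ≡ 2 ∸ suc n % 2
SG-ones zero    = refl
SG-ones (suc n) = begin
  SG (1 ^ₚ suc (suc n))                          ≡⟨ SG-step 1 (1 ^ₚ suc n) ⟩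
  mex₂ (SG (L (1 ^ₚ suc (suc n)))) (SG (1 ^ₚ suc n)) ≡⟨ cong₂ mex₂ (cong SG (L-ones (suc (suc n)))) (SG-ones n) ⟩
  mex₂ 0 (2 ∸ suc n % 2)                         ≡⟨ mex₂-0-∸ (suc n) ⟩
  2 ∸ suc (suc n) % 2                            ∎
  where open ≡-Reasoning

SG-single : ∀ k → SG (suc k ^ₚ 1) ≡ 2 ∸ suc k % 2
SG-single zero    = refl
SG-single (suc k) = begin
  SG (suc (suc k) ^ₚ 1)          ≡⟨ SG-step (suc (suc k)) [] ⟩
  mex₂ (SG (suc k ^ₚ 1)) 0       ≡⟨ cong (λ v → mex₂ v 0) (SG-single k) ⟩
  mex₂ (2 ∸ suc k % 2) 0         ≡⟨ mex₂-∸-0 (suc k) ⟩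
  2 ∸ suc (suc k) % 2            ∎
  where open ≡-Reasoning

SG-pair : ∀ k → SG (suc k ^ₚ 2) ≡ 2 * (suc k % 2)
SG-pair zero    = refl
SG-pair (suc k) = begin
  SG (suc (suc k) ^ₚ 2)                           ≡⟨ SG-step (suc (suc k)) (suc (suc k) ^ₚ 1) ⟩
  mex₂ (SG (suc k ^ₚ 2)) (SG (suc (suc k) ^ₚ 1))   ≡⟨ cong₂ mex₂ (SG-pair k) (SG-single (suc k)) ⟩
  mex₂ (2 * (suc k % 2)) (2 ∸ suc (suc k) % 2)    ≡⟨ mex₂-*-∸ (suc k) ⟩
  2 * (suc (suc k) % 2)                           ∎
  where open ≡-Reasoning

SG-twos : ∀ n → SG (2 ^ₚ suc n) ≡ 2 * (suc n % 2)
SG-twos zero    = refl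
SG-twos (suc n) = begin
  SG (2 ^ₚ suc (suc n))                               ≡⟨ SG-step 2 (2 ^ₚ suc n) ⟩
  mex₂ (SG (L (2 ^ₚ suc (suc n)))) (SG (2 ^ₚ suc n))  ≡⟨ cong₂ mex₂ (cong SG (L-twos (suc (suc n)))) (SG-twos n) ⟩
  mex₂ (SG (1 ^ₚ suc (suc n))) (2 * (suc n % 2))      ≡⟨ cong (λ v → mex₂ v (2 * (suc n % 2))) (SG-ones (suc n)) ⟩
  mex₂ (2 ∸ suc (suc n) % 2) (2 * (suc n % 2))        ≡⟨ mex₂-∸-* (suc n) ⟩
  2 * (suc (suc n) % 2)                               ∎
  where open ≡-Reasoning

lemma3p5 : (n : ℕ) → 1 ≤ n →
    (SG (n ^ₚ 2) ≡ SG (2 ^ₚ n)) ×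
    (n % 2 ≡ 1 → SG (2 ^ₚ n) ≡ 2) ×
    (n % 2 ≡ 0 → SG (2 ^ₚ n) ≡ 0)
lemma3p5 (suc k) _ =
  trans (SG-pair k) (sym (SG-twos k)) ,
  (λ odd  → trans (SG-twos k) (cong (2 *_) odd)) ,
  (λ even → trans (SG-twos k) (cong (2 *_) even))
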